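{- The sparing number of an odd-conjoined graph is $1$, and the sparing number of an even-conjoined graph is $0$.
   Context: All graphs are simple and finite, with no isolated vertices; $\mathbb{N}_0$ denotes the set of non-negative integers. For $A,B\subseteq\mathbb{N}_0$, $A+B=\{a+b: a\in A, b\in B\}$. An integer additive set-indexer (IASI) of a graph $G$ is an injective function $f:V(G)\to 2^{\mathbb{N}_0}$ such that the induced function $g_f:E(G)\to 2^{\mathbb{N}_0}$, $g_f(uv)=f(u)+f(v)$, is also injective. An IASI $f$ is a weak IASI if $|g_f(uv)|=\max(|f(u)|,|f(v)|)$ for every edge $uv$. An element (vertex or edge) whose set-label has cardinality $1$ is called mono-indexed. The sparing number of $G$ is the minimum number of mono-indexed edges required for $G$ to admit a weak IASI. A conjoined graph is a graph $G=\bigcup_{i=1}^n C_{m_i}$ which is a union of cycles all having the same common edge (or common path). It is odd-conjoined if all these cycles are odd cycles, and even-conjoined if all of them are even cycles. -}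

module Defs where

open import Data.Nat using (ℕ; zero; suc; _+_; _∸_; _⊔_; _≤_; _<_; _≟_; _%_; _<ᵇ_)
open import Data.Bool using (if_then_else_)
open import Data.List using (List; []; _∷_; _++_; map; concat; length; filter; deduplicate; cartesianProductWith; upTo; applyUpTo)
open import Data.List.Membership.Propositional using (_∈_)
open import Data.List.Relation.Unary.All using (All)
open import Data.Product using (_×_; _,_; Σ; ∃; ∃-syntax; proj₁; proj₂)
open import Data.Sum using (_⊎_)
open import Function.Bundles using (_⇔_)
open import Relation.Binary.PropositionalEquality using (_≡_; _≢_)

-- Finite sets of natural numbers, represented by lists (duplicates and
-- order irrelevant).  Set-labels are finite subsets of ℕ₀.

FinSet : Set
FinSet = List ℕ

_≈ₛ_ : FinSet → FinSet → Set
A ≈ₛ B = ∀ x → (x ∈ A) ⇔ (x ∈ B)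

card : FinSet → ℕ
card A = length (deduplicate _≟_ A)

_⊕_ : FinSet → FinSet → FinSet
A ⊕ B = cartesianProductWith _+_ A B

-- Graphs: a (finite) graph on vertex type V is given by its list of
-- edges; its vertices are exactly the endpoints of edges (so there are
-- no isolated vertices).  For the concrete graphs below the list contains
-- each edge exactly once and no loops.

Graph : Set → Set
Graph V = List (V × V)

_∈V_ : {V : Set} → V → Graph V → Set
v ∈V G = ∃[ w ] (((v , w) ∈ G) ⊎ ((w , v) ∈ G))

module _ {V : Set} (G : Graph V) (f : V → FinSet) where

  gf : V × V → FinSet
  gf (u , v) = f u ⊕ f v

  IsIASI : Set
  IsIASI =
    (∀ u v → u ∈V G → v ∈V G → f u ≈ₛ f v → u ≡ v) ×
    (∀ e e′ → e ∈ G → e′ ∈ G → gf e ≈ₛ gf e′ → e ≡ e′)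

  IsWeakIASI : Set
  IsWeakIASI = IsIASI ×
    (∀ u v → (u , v) ∈ G → card (f u ⊕ f v) ≡ card (f u) ⊔ card (f v))

  monoEdges : ℕ
  monoEdges = length (filter (λ e → card (gf e) ≟ 1) G)

IsSparingNumber : {V : Set} → Graph V → ℕ → Set
IsSparingNumber {V} G s =
  (Σ (V → FinSet) λ f → IsWeakIASI G f × monoEdges G f ≡ s) ×
  (∀ (f : V → FinSet) → IsWeakIASI G f → s ≤ monoEdges G f)

-- Parameters: k = length (number of edges) of the common path P,
-- ls = (l₁ , … , lₙ), lᵢ = length of the path Qᵢ such that the i-th cycle
-- is C_{mᵢ} = P ∪ Qᵢ with mᵢ = k + lᵢ.  The paths Qᵢ join the two ends of
-- P and are internally disjoint from P and from each other, so the
-- cycles pairwise intersect exactly in the common path P.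

data CV : Set where
  pv : ℕ → CV          -- pv j : j-th vertex of the common path, 0 ≤ j ≤ k
  qv : ℕ → ℕ → CV      -- qv i j : j-th internal vertex of Qᵢ, 1 ≤ j < lᵢ

pathP : ℕ → Graph CV
pathP k = applyUpTo (λ j → (pv j , pv (suc j))) k

qvert : ℕ → ℕ → ℕ → ℕ → CV
qvert k i l zero = pv 0
qvert k i l (suc j) = if suc j <ᵇ l then qv i (suc j) else pv k

pathQ : ℕ → ℕ → ℕ → Graph CV
pathQ k i l = applyUpTo (λ j → (qvert k i l j , qvert k i l (suc j))) l

pathsQ : ℕ → ℕ → List ℕ → Graph CV
pathsQ k i []       = []
pathsQ k i (l ∷ ls) = pathQ k i l ++ pathsQ k (suc i) ls

conjoined : ℕ → List ℕ → Graph CV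
conjoined k ls = pathP k ++ pathsQ k 0 ls

ones : List ℕ → ℕ
ones ls = length (filter (_≟ 1) ls)

-- admissible parameters: P has at least one edge, there is at least one
-- cycle, every Qᵢ has at least one edge, every cycle has length ≥ 3, and
-- at most one Qᵢ is a single edge (the graph is simple and the cycles
-- are distinct)
ConjoinedParams : ℕ → List ℕ → Set
ConjoinedParams k ls =
  1 ≤ k × 1 ≤ length ls × All (1 ≤_) ls × All (λ l → 3 ≤ k + l) ls × ones ls ≤ 1

OddConjoined : ℕ → List ℕ → Set
OddConjoined k ls = All (λ l → (k + l) % 2 ≡ 1) ls

EvenConjoined : ℕ → List ℕ → Set
EvenConjoined k ls = All (λ l → (k + l) % 2 ≡ 0) ls

module Submission where

-- In a weak IASI the two labels of an edge cannot both have
-- at least two elements, since |A + B| > max(|A|,|B|) for such sets.  Hence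
-- on an edge that is not mono-indexed exactly one endpoint has a "large"
-- label (two or more elements), and a weak IASI without mono-indexed edges
-- yields a proper 2-colouring of the graph.  An odd-conjoined graph
-- contains an odd cycle (the common path P followed back along Q₀), so it
-- has no proper 2-colouring and every weak IASI has a mono-indexed edge.
--
-- Conversely, a 2-colouring gives a labelling v ↦ {xᵥ} or
-- {xᵥ, xᵥ+1} with xᵥ = 2^code(v), where the labels on each edge are not both
-- large.  Since sums of two distinct powers of two determine the summands,
-- this is a weak IASI, and an edge is mono-indexed exactly when both ends
-- are small.  An even-conjoined graph is properly 2-colourable, and an
-- odd-conjoined graph becomes so after deleting the first edge of P.

open import Defs
open import Data.Bool using (false; if_then_else_)
open import Data.Bool.Properties using (T-≡)
open import Data.Unit using (⊤; tt)
open import Data.List using (List; []; _∷_; _++_; map; length; filter; deduplicate; applyUpTo)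
open import Data.List.Membership.Propositional using (_∈_; _∉_)
open import Data.List.Membership.Propositional.Properties
  using (∈-deduplicate⁺; ∈-deduplicate⁻; ∈-map⁻; ∈-filter⁺; ∈-length; ∈-cartesianProductWith⁺;
         ∈-cartesianProductWith⁻; ∈-applyUpTo⁺; ∈-++⁺ˡ; ∈-++⁺ʳ)
open import Data.List.Properties using (length-map; filter-notAll; filter-accept; filter-none)
open import Data.List.Relation.Unary.All as All using (All; []; _∷_)
open import Data.List.Relation.Unary.All.Properties using (applyUpTo⁺₁; ++⁺)
open import Data.List.Relation.Unary.Any as Any using (Any; here; there)
open import Data.List.Relation.Unary.Unique.Propositional using (Unique; _∷_)
open import Data.List.Relation.Unary.Unique.Propositional.Properties as Unique using ()
open import Data.List.Relation.Unary.Unique.DecPropositional.Properties using (deduplicate-!)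
open import Data.Nat using (ℕ; zero; suc; _+_; _∸_; _⊔_; _≤_; _<_; _%_; _<ᵇ_; z≤n; s≤s; parity)
open import Data.Nat.Properties
open import Algebra.Properties.CommutativeSemigroup +-commutativeSemigroup using (interchange)
open import Data.List.Extrema ≤-totalOrder using (max; argmax-sel; ⊥≤max; xs≤max)
open import Data.Parity.Base as ℙ using (Parity; 0ℙ; 1ℙ; _⁻¹)
open import Data.Parity.Properties using (⁻¹-selfInverse; p+p≡0ℙ; suc-homo-⁻¹; +-homo-+)
  renaming (+-cancelˡ-≡ to ℙ-+-cancelˡ-≡; +-identityʳ to ℙ-+-identityʳ)
open import Data.Product using (_×_; _,_; proj₁; proj₂; ∃-syntax)
open import Data.Sum using (_⊎_; inj₁; inj₂; [_,_]′)
open import Function.Bundles using (Equivalence; mk⇔)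
open import Relation.Binary.Definitions using (tri<; tri≈; tri>)
open import Relation.Binary.PropositionalEquality
open import Relation.Nullary using (¬_; ¬?; Dec; yes; no; contradiction)

unique⊆⇒length≤ : ∀ {U X : List ℕ} → Unique U → (∀ {z} → z ∈ U → z ∈ X) → length U ≤ length X
unique⊆⇒length≤ {[]}    _            _    = z≤n
unique⊆⇒length≤ {u ∷ U} {X} (u∉U ∷ uniqU) U⊆X =
  ≤-trans (s≤s (unique⊆⇒length≤ uniqU U⊆X-u)) (filter-notAll ≢u? X u∈X)
  where
  ≢u? : (z : ℕ) → Dec (u ≢ z)
  ≢u? z = ¬? (u ≟ z)
  U⊆X-u : ∀ {z} → z ∈ U → z ∈ filter ≢u? X
  U⊆X-u z∈U = ∈-filter⁺ ≢u? (U⊆X (there z∈U)) (All.lookup u∉U z∈U)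
  u∈X : Any (λ z → ¬ ¬ (u ≡ z)) X
  u∈X = Any.map (λ u≡z u≢z → u≢z u≡z) (U⊆X (here refl))

two-elements : ∀ B → 2 ≤ card B → ∃[ b₁ ] ∃[ b₂ ] (b₁ ∈ B × b₂ ∈ B × b₁ < b₂)
two-elements B 2≤card with deduplicate _≟_ B | deduplicate-! _≟_ B | ∈-deduplicate⁻ _≟_ B
... | []        | _ | _ = contradiction 2≤card λ ()
... | _ ∷ []    | _ | _ = contradiction 2≤card λ { (s≤s ()) }
... | x ∷ y ∷ _ | (x≢y ∷ _) ∷ _ | D⊆B with <-cmp x y
...   | tri< x<y _ _ = x , y , D⊆B (here refl) , D⊆B (there (here refl)) , x<y
...   | tri≈ _ x≡y _ = contradiction x≡y x≢y
...   | tri> _ _ y<x = y , x , D⊆B (there (here refl)) , D⊆B (here refl) , y<x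

maximum : ∀ {a} {A : List ℕ} → a ∈ A → ∃[ m ] (m ∈ A × All (_≤ m) A)
maximum {A = a ∷ as} _ =
  max a as , [ (λ m≡a → here m≡a) , there ]′ (argmax-sel (λ x → x) a as) , ⊥≤max a as ∷ xs≤max a as

-- If S contains A + B and B has two elements b₁ < b₂, then |A| < |S|:
-- the translate A + b₁ has |A| elements, and (max A) + b₂ exceeds all of them.
card<card-sumset : ∀ {a b₁ b₂} (A B S : FinSet) → a ∈ A → b₁ ∈ B → b₂ ∈ B → b₁ < b₂ →
  (∀ {x y} → x ∈ A → y ∈ B → x + y ∈ S) → card A < card S
card<card-sumset {b₁ = b₁} {b₂} A B S a∈A b₁∈B b₂∈B b₁<b₂ A+B⊆S
  with m , m∈A , A≤m ← maximum a∈A =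
  subst (_≤ card S) (cong suc (length-map (_+ b₁) DA)) (unique⊆⇒length≤ uniqueU U⊆S)
  where
  DA : List ℕ
  DA = deduplicate _≟_ A
  U : List ℕ
  U = m + b₂ ∷ map (_+ b₁) DA
  top-new : All (m + b₂ ≢_) (map (_+ b₁) DA)
  top-new = All.tabulate above
    where
    above : ∀ {z} → z ∈ map (_+ b₁) DA → m + b₂ ≢ z
    above z∈ with x , x∈ , refl ← ∈-map⁻ (_+ b₁) z∈ =
      >⇒≢ (+-mono-≤-< (All.lookup A≤m (∈-deduplicate⁻ _≟_ A x∈)) b₁<b₂)
  uniqueU : Unique U
  uniqueU = top-new ∷ Unique.map⁺ (+-cancelʳ-≡ b₁ _ _) (deduplicate-! _≟_ A)
  U⊆S : ∀ {z} → z ∈ U → z ∈ deduplicate _≟_ S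
  U⊆S (here refl) = ∈-deduplicate⁺ _≟_ (A+B⊆S m∈A b₂∈B)
  U⊆S (there z∈) with x , x∈ , refl ← ∈-map⁻ (_+ b₁) z∈ = ∈-deduplicate⁺ _≟_ (A+B⊆S (∈-deduplicate⁻ _≟_ A x∈) b₁∈B)

-- The sumset inequality |A + B| > max(|A|, |B|) for |A|, |B| ≥ 2: this is why
-- the labels of an edge in a weak IASI are never both large.
card-sumset-large : ∀ A B → 2 ≤ card A → 2 ≤ card B → card A ⊔ card B < card (A ⊕ B)
card-sumset-large A B 2≤|A| 2≤|B|
  with a₁ , a₂ , a₁∈A , a₂∈A , a₁<a₂ ← two-elements A 2≤|A|
     | b₁ , b₂ , b₁∈B , b₂∈B , b₁<b₂ ← two-elements B 2≤|B| =
  ⊔-lub (card<card-sumset A B (A ⊕ B) a₁∈A b₁∈B b₂∈B b₁<b₂ (∈-cartesianProductWith⁺ _+_))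
        (card<card-sumset B A (A ⊕ B) b₁∈B a₁∈A a₂∈A a₁<a₂ B+A⊆A+B)
  where
  B+A⊆A+B : ∀ {y x} → y ∈ B → x ∈ A → y + x ∈ A ⊕ B
  B+A⊆A+B {y} {x} y∈B x∈A = subst (_∈ A ⊕ B) (+-comm x y) (∈-cartesianProductWith⁺ _+_ x∈A y∈B)

card≡0⇒empty : ∀ A → card A ≡ 0 → A ≡ []
card≡0⇒empty [] _ = refl

≡⇒≈ₛ : ∀ {A B : FinSet} → A ≡ B → A ≈ₛ B
≡⇒≈ₛ refl _ = mk⇔ (λ x∈ → x∈) (λ x∈ → x∈)

Proper : {V : Set} → (V → Parity) → V × V → Set
Proper b (u , v) = b u ≡ b v ⁻¹

large : ℕ → Parity
large (suc (suc _)) = 1ℙ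
large _             = 0ℙ

-- Label sizes m, n on an edge that is not mono-indexed in a weak IASI
-- (so max(m, n) ≠ 1), whose labels are not both empty and not both large,
-- have different colours.
sizes-alternate : ∀ m n → m ⊔ n ≢ 0 → m ⊔ n ≢ 1 → ¬ (2 ≤ m × 2 ≤ n) → large m ≡ large n ⁻¹
sizes-alternate 0             0             ≢0 _  _    = contradiction refl ≢0
sizes-alternate 0             1             _  ≢1 _    = contradiction refl ≢1
sizes-alternate 1             0             _  ≢1 _    = contradiction refl ≢1
sizes-alternate 1             1             _  ≢1 _    = contradiction refl ≢1
sizes-alternate 0             (suc (suc _)) _  _  _    = refl
sizes-alternate 1             (suc (suc _)) _  _  _    = refl
sizes-alternate (suc (suc _)) 0             _  _  _    = refl
sizes-alternate (suc (suc _)) 1             _  _  _    = refl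
sizes-alternate (suc (suc _)) (suc (suc _)) _  _  both = contradiction (s≤s (s≤s z≤n) , s≤s (s≤s z≤n)) both

module _ {V : Set} (G : Graph V) (f : V → FinSet) where

  no-mono-edge : monoEdges G f ≡ 0 → ∀ {e} → e ∈ G → card (gf G f e) ≢ 1
  no-mono-edge none e∈G |e|≡1 =
    <-irrefl refl (subst (0 <_) none (∈-length (∈-filter⁺ (λ e → card (gf G f e) ≟ 1) e∈G |e|≡1)))

  weak-IASI-colouring : IsWeakIASI G f → (∀ {u v} → (u , v) ∈ G → u ≢ v) → monoEdges G f ≡ 0 →
    All (Proper (λ v → large (card (f v)))) G
  weak-IASI-colouring ((vertex-injective , _) , weak) loopless none = All.tabulate proper
    where
    proper : ∀ {e} → e ∈ G → Proper (λ v → large (card (f v))) e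
    proper {u , v} e∈G = sizes-alternate (card (f u)) (card (f v)) not-empty not-mono not-both-large
      where
      |e|≡max : card (f u ⊕ f v) ≡ card (f u) ⊔ card (f v)
      |e|≡max = weak u v e∈G
      not-empty : card (f u) ⊔ card (f v) ≢ 0
      not-empty max≡0 = loopless e∈G (vertex-injective u v (v , inj₁ e∈G) (u , inj₂ e∈G) (≡⇒≈ₛ fu≡fv))
        where
        fu≡fv : f u ≡ f v
        fu≡fv = trans (card≡0⇒empty (f u) (n≤0⇒n≡0 (subst (card (f u) ≤_) max≡0 (m≤m⊔n _ _))))
                  (sym (card≡0⇒empty (f v) (n≤0⇒n≡0 (subst (card (f v) ≤_) max≡0 (m≤n⊔m _ _)))))
      not-mono : card (f u) ⊔ card (f v) ≢ 1
      not-mono max≡1 = no-mono-edge none e∈G (trans |e|≡max max≡1)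
      not-both-large : ¬ (2 ≤ card (f u) × 2 ≤ card (f v))
      not-both-large (2≤|fu| , 2≤|fv|) = <-irrefl (sym |e|≡max) (card-sumset-large (f u) (f v) 2≤|fu| 2≤|fv|)

⁻¹-+ʳ : ∀ p q → (p ℙ.+ q) ⁻¹ ≡ p ℙ.+ q ⁻¹
⁻¹-+ʳ 0ℙ _ = refl
⁻¹-+ʳ 1ℙ _ = refl

parity-suc : ∀ n → parity (suc n) ≡ parity n ⁻¹
parity-suc n = sym (⁻¹-selfInverse (suc-homo-⁻¹ n))

module _ {V : Set} {G : Graph V} {b : V → Parity} (proper : All (Proper b) G) where

  walk-colour : (w : ℕ → V) (n : ℕ) → (∀ j → j < n → (w j , w (suc j)) ∈ G) →
    b (w n) ≡ b (w 0) ℙ.+ parity n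
  walk-colour w zero    _     = sym (ℙ-+-identityʳ (b (w 0)))
  walk-colour w (suc n) steps = begin
    b (w (suc n))                   ≡⟨ sym (⁻¹-selfInverse (sym (All.lookup proper (steps n ≤-refl)))) ⟩
    b (w n) ⁻¹                      ≡⟨ cong _⁻¹ (walk-colour w n (λ j j<n → steps j (m<n⇒m<1+n j<n))) ⟩
    (b (w 0) ℙ.+ parity n) ⁻¹       ≡⟨ ⁻¹-+ʳ (b (w 0)) (parity n) ⟩
    b (w 0) ℙ.+ parity n ⁻¹         ≡⟨ cong (b (w 0) ℙ.+_) (sym (parity-suc n)) ⟩
    b (w 0) ℙ.+ parity (suc n)      ∎
    where open ≡-Reasoning

  walks-same-parity : (w w′ : ℕ → V) (m n : ℕ) →
    (∀ j → j < m → (w j , w (suc j)) ∈ G) → (∀ j → j < n → (w′ j , w′ (suc j)) ∈ G) →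
    w 0 ≡ w′ 0 → w m ≡ w′ n → parity m ≡ parity n
  walks-same-parity w w′ m n steps steps′ same-start same-end =
    ℙ-+-cancelˡ-≡ (b (w 0)) (parity m) (parity n) (begin
      b (w 0) ℙ.+ parity m    ≡⟨ sym (walk-colour w m steps) ⟩
      b (w m)                 ≡⟨ cong b same-end ⟩
      b (w′ n)                ≡⟨ walk-colour w′ n steps′ ⟩
      b (w′ 0) ℙ.+ parity n   ≡⟨ cong (λ x → b x ℙ.+ parity n) (sym same-start) ⟩
      b (w 0) ℙ.+ parity n    ∎)
    where open ≡-Reasoning

odd≢double : ∀ m n → suc (m + m) ≢ n + n
odd≢double m n eq = contradiction 1ℙ≡0ℙ λ ()
  where
  double-even : ∀ k → parity (k + k) ≡ 0ℙ
  double-even k = trans (+-homo-+ k k) (p+p≡0ℙ (parity k))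
  open ≡-Reasoning
  1ℙ≡0ℙ : 1ℙ ≡ 0ℙ
  1ℙ≡0ℙ = begin
    1ℙ                      ≡⟨ cong _⁻¹ (sym (double-even m)) ⟩
    parity (m + m) ⁻¹       ≡⟨ sym (parity-suc (m + m)) ⟩
    parity (suc (m + m))    ≡⟨ cong parity eq ⟩
    parity (n + n)          ≡⟨ double-even n ⟩
    0ℙ                      ∎

double-injective : ∀ m n → m + m ≡ n + n → m ≡ n
double-injective m n eq with <-cmp m n
... | tri< m<n _ _ = contradiction eq (<⇒≢ (+-mono-< m<n m<n))
... | tri≈ _ m≡n _ = m≡n
... | tri> _ _ n<m = contradiction eq (>⇒≢ (+-mono-< n<m n<m))

-- pair a b = 2^a · (2b + 1): every positive integer has exactly one such
-- representation, so pair is injective.  It encodes vertices as numbers.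
pair : ℕ → ℕ → ℕ
pair zero    b = suc (b + b)
pair (suc a) b = pair a b + pair a b

pair-injective : ∀ a b a′ b′ → pair a b ≡ pair a′ b′ → a ≡ a′ × b ≡ b′
pair-injective zero    b zero     b′ eq = refl , double-injective b b′ (suc-injective eq)
pair-injective zero    b (suc a′) b′ eq = contradiction eq (odd≢double b (pair a′ b′))
pair-injective (suc a) b zero     b′ eq = contradiction (sym eq) (odd≢double b′ (pair a b))
pair-injective (suc a) b (suc a′) b′ eq
  with refl , b≡b′ ← pair-injective a b a′ b′ (double-injective (pair a b) (pair a′ b′) eq) = refl , b≡b′

pow2 : ℕ → ℕ
pow2 a = pair a 0

pow2-injective : ∀ a b → pow2 a ≡ pow2 b → a ≡ b
pow2-injective a b eq = proj₁ (pair-injective a 0 b 0 eq)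

SamePair : ℕ → ℕ → ℕ → ℕ → Set
SamePair a b c d = (a ≡ c × b ≡ d) ⊎ (a ≡ d × b ≡ c)

-- The powers of two form a Sidon set: 2^a + 2^b with a ≠ b determines
-- {a, b} (uniqueness of binary expansions).  First the case a = 0, where
-- the sum is odd, so exactly one of c, d must be 0.
sidon-one : ∀ b c d → c ≢ d → pow2 0 + pow2 (suc b) ≡ pow2 c + pow2 d → SamePair 0 (suc b) c d
sidon-one b zero    zero    c≢d _  = contradiction refl c≢d
sidon-one b zero    (suc d) _   eq = inj₁ (refl , pow2-injective (suc b) (suc d) (suc-injective eq))
sidon-one b (suc c) zero    _   eq =
  inj₂ (refl , pow2-injective (suc b) (suc c) (suc-injective (trans eq (+-comm (pow2 (suc c)) 1))))
sidon-one b (suc c) (suc d) _   eq =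
  contradiction (trans eq (interchange (pow2 c) (pow2 c) (pow2 d) (pow2 d))) (odd≢double (pow2 b) (pow2 c + pow2 d))

sidon : ∀ a b c d → a ≢ b → c ≢ d → pow2 a + pow2 b ≡ pow2 c + pow2 d → SamePair a b c d
sidon zero    zero    _       _       a≢b _   _  = contradiction refl a≢b
sidon zero    (suc b) c       d       _   c≢d eq = sidon-one b c d c≢d eq
sidon (suc a) zero    c       d       _   c≢d eq with sidon-one a c d c≢d (trans (+-comm 1 (pow2 (suc a))) eq)
... | inj₁ (0≡c , a≡d) = inj₂ (a≡d , 0≡c)
... | inj₂ (0≡d , a≡c) = inj₁ (a≡c , 0≡d)
sidon (suc a) (suc b) zero    zero    _   c≢d _  = contradiction refl c≢d
sidon (suc a) (suc b) zero    (suc d) a≢b _   eq with sidon-one d (suc a) (suc b) a≢b (sym eq)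
... | inj₁ (() , _)
... | inj₂ (() , _)
sidon (suc a) (suc b) (suc c) zero    a≢b _   eq
  with sidon-one c (suc a) (suc b) a≢b (trans (+-comm 1 (pow2 (suc c))) (sym eq))
... | inj₁ (() , _)
... | inj₂ (() , _)
sidon (suc a) (suc b) (suc c) (suc d) a≢b c≢d eq
  with sidon a b c d (λ a≡b → a≢b (cong suc a≡b)) (λ c≡d → c≢d (cong suc c≡d)) halves-equal
  where
  halves-equal : pow2 a + pow2 b ≡ pow2 c + pow2 d
  halves-equal = double-injective _ _ (begin
    (pow2 a + pow2 b) + (pow2 a + pow2 b)   ≡⟨ interchange (pow2 a) (pow2 b) (pow2 a) (pow2 b) ⟩
    pow2 (suc a) + pow2 (suc b)             ≡⟨ eq ⟩
    pow2 (suc c) + pow2 (suc d)             ≡⟨ interchange (pow2 c) (pow2 c) (pow2 d) (pow2 d) ⟩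
    (pow2 c + pow2 d) + (pow2 c + pow2 d)   ∎)
    where open ≡-Reasoning
... | inj₁ (refl , refl) = inj₁ (refl , refl)
... | inj₂ (refl , refl) = inj₂ (refl , refl)

IsMin : ℕ → FinSet → Set
IsMin x A = x ∈ A × (∀ {z} → z ∈ A → x ≤ z)

min-unique : ∀ {x y A B} → IsMin x A → IsMin y B → A ≈ₛ B → x ≡ y
min-unique (x∈A , x≤A) (y∈B , y≤B) A≈B =
  ≤-antisym (x≤A (Equivalence.from (A≈B _) y∈B)) (y≤B (Equivalence.to (A≈B _) x∈A))

sumset-min : ∀ {x y A B} → IsMin x A → IsMin y B → IsMin (x + y) (A ⊕ B)
sumset-min {x} {y} {A} {B} (x∈A , x≤A) (y∈B , y≤B) = ∈-cartesianProductWith⁺ _+_ x∈A y∈B , bound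
  where
  bound : ∀ {z} → z ∈ A ⊕ B → x + y ≤ z
  bound z∈ with a , b , a∈A , b∈B , refl ← ∈-cartesianProductWith⁻ _+_ A B z∈ = +-mono-≤ (x≤A a∈A) (y≤B b∈B)

card-pair : ∀ x y → x ≢ y → card (x ∷ y ∷ []) ≡ 2
card-pair x y x≢y = cong (λ ys → suc (length ys)) (filter-accept (λ z → ¬? (x ≟ z)) x≢y)

label : Parity → ℕ → FinSet
label 0ℙ x = x ∷ []
label 1ℙ x = x ∷ suc x ∷ []

size : Parity → ℕ
size 0ℙ = 1
size 1ℙ = 2

label-min : ∀ p x → IsMin x (label p x)
label-min 0ℙ x = here refl , λ { (here refl) → ≤-refl }
label-min 1ℙ x = here refl , λ { (here refl) → ≤-refl ; (there (here refl)) → n≤1+n x }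

card-label : ∀ p x → card (label p x) ≡ size p
card-label 0ℙ x = refl
card-label 1ℙ x = card-pair x (suc x) (<⇒≢ (n<1+n x))

-- If at least one of two labels is small, their sum is a translate of the
-- other one, so it has the larger of the two sizes.
card-label-sum : ∀ p q x y → p ≡ 0ℙ ⊎ q ≡ 0ℙ → card (label p x ⊕ label q y) ≡ size p ⊔ size q
card-label-sum 0ℙ 0ℙ x y _ = refl
card-label-sum 1ℙ 0ℙ x y _ = card-pair (x + y) (suc x + y) (<⇒≢ (n<1+n (x + y)))
card-label-sum 0ℙ 1ℙ x y _ = card-pair (x + y) (x + suc y) (<⇒≢ (+-monoʳ-< x (n<1+n y)))
card-label-sum 1ℙ 1ℙ x y (inj₁ ())
card-label-sum 1ℙ 1ℙ x y (inj₂ ())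

different⇒one-small : ∀ {p q} → p ≡ q ⁻¹ → p ≡ 0ℙ ⊎ q ≡ 0ℙ
different⇒one-small {q = 0ℙ} _   = inj₂ refl
different⇒one-small {q = 1ℙ} p≡0 = inj₁ p≡0

two-sizes-large : ∀ q → size (q ⁻¹) ⊔ size q ≢ 1
two-sizes-large 0ℙ ()
two-sizes-large 1ℙ ()

Oriented : {V : Set} → Graph V → Set
Oriented G = ∀ {u v} → (u , v) ∈ G → u ≢ v × (v , u) ∉ G

forward-oriented : ∀ {V : Set} {G : Graph V} {_R_ : V → V → Set} →
  (∀ {u v} → u R v → ¬ v R u) → All (λ (u , v) → u R v) G → Oriented G
forward-oriented asym forward uv∈G =
  (λ { refl → asym (All.lookup forward uv∈G) (All.lookup forward uv∈G) }) ,
  (λ vu∈G → asym (All.lookup forward uv∈G) (All.lookup forward vu∈G))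

module Labelling {V : Set} (code : V → ℕ) (code-injective : ∀ u v → code u ≡ code v → u ≡ v)
                 (c : V → Parity) where

  base : V → ℕ
  base v = pow2 (code v)

  labelling : V → FinSet
  labelling v = label (c v) (base v)

  -- The minimum of a vertex label recovers the vertex.
  labelling-injective : ∀ u v → labelling u ≈ₛ labelling v → u ≡ v
  labelling-injective u v lu≈lv =
    code-injective u v (pow2-injective _ _ (min-unique (label-min (c u) (base u)) (label-min (c v) (base v)) lu≈lv))

  -- The minimum 2^code(u) + 2^code(v) of an edge label recovers the edge
  -- up to orientation, by the Sidon property.
  edge-labelling-injective : ∀ {G : Graph V} → Oriented G → ∀ e e′ → e ∈ G → e′ ∈ G → gf G labelling e ≈ₛ gf G labelling e′ → e ≡ e′
  edge-labelling-injective {G} oriented (u , v) (u′ , v′) e∈G e′∈G le≈le′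
    with sidon (code u) (code v) (code u′) (code v′) (code-distinct e∈G) (code-distinct e′∈G) same-min
    where
    code-distinct : ∀ {x y} → (x , y) ∈ G → code x ≢ code y
    code-distinct xy∈G cx≡cy = proj₁ (oriented xy∈G) (code-injective _ _ cx≡cy)
    edge-min : ∀ x y → IsMin (base x + base y) (labelling x ⊕ labelling y)
    edge-min x y = sumset-min (label-min (c x) (base x)) (label-min (c y) (base y))
    same-min : base u + base v ≡ base u′ + base v′
    same-min = min-unique (edge-min u v) (edge-min u′ v′) le≈le′
  ... | inj₁ (cu≡cu′ , cv≡cv′) with refl ← code-injective _ _ cu≡cu′ | refl ← code-injective _ _ cv≡cv′ = refl
  ... | inj₂ (cu≡cv′ , cv≡cu′) with refl ← code-injective _ _ cu≡cv′ | refl ← code-injective _ _ cv≡cu′ =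
    contradiction e′∈G (proj₂ (oriented e∈G))

  colouring-weak-IASI : ∀ {G : Graph V} → Oriented G → All (λ (u , v) → c u ≡ 0ℙ ⊎ c v ≡ 0ℙ) G → IsWeakIASI G labelling
  colouring-weak-IASI {G} oriented small-end =
    ((λ u v _ _ → labelling-injective u v) , (λ e e′ → edge-labelling-injective oriented e e′)) , weak
    where
    weak : ∀ u v → (u , v) ∈ G → card (labelling u ⊕ labelling v) ≡ card (labelling u) ⊔ card (labelling v)
    weak u v uv∈G = begin
      card (labelling u ⊕ labelling v)           ≡⟨ card-label-sum (c u) (c v) (base u) (base v) (All.lookup small-end uv∈G) ⟩
      size (c u) ⊔ size (c v)                    ≡⟨ sym (cong₂ _⊔_ (card-label (c u) (base u)) (card-label (c v) (base v))) ⟩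
      card (labelling u) ⊔ card (labelling v)    ∎
      where open ≡-Reasoning

  -- A properly coloured edge has a large end, so it is not mono-indexed.
  proper-not-mono : ∀ {u v} → Proper c (u , v) → card (labelling u ⊕ labelling v) ≢ 1
  proper-not-mono {u} {v} cu≡cv⁻¹ |e|≡1 = two-sizes-large (c v) (begin
    size (c v ⁻¹) ⊔ size (c v)          ≡⟨ cong (λ p → size p ⊔ size (c v)) (sym cu≡cv⁻¹) ⟩
    size (c u) ⊔ size (c v)             ≡⟨ sym (card-label-sum (c u) (c v) (base u) (base v) (different⇒one-small cu≡cv⁻¹)) ⟩
    card (labelling u ⊕ labelling v)    ≡⟨ |e|≡1 ⟩
    1                                   ∎)
    where open ≡-Reasoning

  mono-count-proper : (G xs : Graph V) → All (Proper c) xs →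
    length (filter (λ e → card (gf G labelling e) ≟ 1) xs) ≡ 0
  mono-count-proper G xs proper =
    cong length (filter-none (λ e → card (gf G labelling e) ≟ 1) (All.map proper-not-mono proper))

code : CV → ℕ
code (pv j)   = pair 0 j
code (qv i j) = pair (suc i) j

code-injective : ∀ u v → code u ≡ code v → u ≡ v
code-injective (pv a)   (pv b)    eq with pair-injective 0 a 0 b eq
... | _ , refl = refl
code-injective (pv a)   (qv i b)  eq with pair-injective 0 a (suc i) b eq
... | () , _
code-injective (qv i a) (pv b)    eq with pair-injective (suc i) a 0 b eq
... | () , _
code-injective (qv i a) (qv i′ b) eq with pair-injective (suc i) a (suc i′) b eq
... | refl , refl = refl

-- The edges of a conjoined graph go forward for ≺: along P and along each
-- Qᵢ the index increases, and Qᵢ runs from pv 0 to pv k with k ≥ 1.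
_≺_ : CV → CV → Set
pv a   ≺ pv b   = a < b
pv a   ≺ qv _ _ = a ≡ 0
qv _ _ ≺ pv b   = 1 ≤ b
qv _ a ≺ qv _ b = a < b

≺-asym : ∀ {u v} → u ≺ v → ¬ v ≺ u
≺-asym {pv _}   {pv _}   a<b  b<a = <-asym a<b b<a
≺-asym {pv _}   {qv _ _} refl ()
≺-asym {qv _ _} {pv _}   ()   refl
≺-asym {qv _ _} {qv _ _} a<b  b<a = <-asym a<b b<a

n<ᵇn : ∀ n → (n <ᵇ n) ≡ false
n<ᵇn zero    = refl
n<ᵇn (suc n) = n<ᵇn n

qvert-inner : ∀ {k i l} j → suc j < l → qvert k i l (suc j) ≡ qv i (suc j)
qvert-inner {k} {i} j sj<l = cong (λ b → if b then qv i (suc j) else pv k) (Equivalence.to T-≡ (<⇒<ᵇ sj<l))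

qvert-end : ∀ k i l → qvert k i (suc l) (suc l) ≡ pv k
qvert-end k i l = cong (λ b → if b then qv i (suc l) else pv k) (n<ᵇn l)

data QEdge (k i : ℕ) : ℕ → CV → CV → Set where
  direct : QEdge k i 1 (pv 0) (pv k)
  first  : ∀ {l} → QEdge k i l (pv 0) (qv i 1)
  inner  : ∀ {l j} → QEdge k i l (qv i j) (qv i (suc j))
  last   : ∀ {j} → QEdge k i (suc j) (qv i j) (pv k)

q-last-edge : ∀ k i j → QEdge k i (suc (suc j)) (qvert k i (suc (suc j)) (suc j)) (qvert k i (suc (suc j)) (suc (suc j)))
q-last-edge k i j = subst₂ (QEdge k i (suc (suc j))) (sym (qvert-inner j ≤-refl)) (sym (qvert-end k i (suc j))) last

q-edge : ∀ k i l j → j < l → QEdge k i l (qvert k i l j) (qvert k i l (suc j))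
q-edge k i (suc zero)    zero    _   = direct
q-edge k i (suc (suc l)) zero    _   = first
q-edge k i l             (suc j) sj<l with suc (suc j) <? l
... | yes ssj<l = subst₂ (QEdge k i l) (sym (qvert-inner j sj<l)) (sym (qvert-inner (suc j) ssj<l)) inner
... | no  ssj≮l = subst (λ l → QEdge k i l (qvert k i l (suc j)) (qvert k i l (suc (suc j))))
                        (≤-antisym sj<l (≮⇒≥ ssj≮l)) (q-last-edge k i j)

all-pathsQ : ∀ {P : CV × CV → Set} {Admissible : ℕ → Set} k →
  (∀ {i l u v} → Admissible l → QEdge k i l u v → P (u , v)) →
  ∀ i ls → All Admissible ls → All P (pathsQ k i ls)
all-pathsQ k q-edge-P i []       []                  = []
all-pathsQ k q-edge-P i (l ∷ ls) (admissible ∷ rest) =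
  ++⁺ (applyUpTo⁺₁ _ l (λ {j} j<l → q-edge-P admissible (q-edge k i l j j<l))) (all-pathsQ k q-edge-P (suc i) ls rest)

conjoined-oriented : ∀ k ls → 1 ≤ k → Oriented (conjoined k ls)
conjoined-oriented k ls 1≤k =
  forward-oriented ≺-asym (++⁺ (applyUpTo⁺₁ _ k (λ _ → ≤-refl)) (all-pathsQ k q-edge-forward 0 ls (All.universal (λ _ → tt) ls)))
  where
  q-edge-forward : ∀ {i l u v} → ⊤ → QEdge k i l u v → u ≺ v
  q-edge-forward _ direct = 1≤k
  q-edge-forward _ first  = refl
  q-edge-forward _ inner  = ≤-refl
  q-edge-forward _ last   = 1≤k

parity-mod2 : ∀ n → parity n ≡ parity (n % 2)
parity-mod2 zero          = refl
parity-mod2 (suc zero)    = refl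
parity-mod2 (suc (suc n)) = parity-mod2 n

even⇒parity-0ℙ : ∀ n → n % 2 ≡ 0 → parity n ≡ 0ℙ
even⇒parity-0ℙ n n-even = trans (parity-mod2 n) (cong parity n-even)

odd⇒parity-1ℙ : ∀ n → n % 2 ≡ 1 → parity n ≡ 1ℙ
odd⇒parity-1ℙ n n-odd = trans (parity-mod2 n) (cong parity n-odd)

odd-suc⇒parity-0ℙ : ∀ n → suc n % 2 ≡ 1 → parity n ≡ 0ℙ
odd-suc⇒parity-0ℙ n sn-odd = trans (sym (suc-homo-⁻¹ n)) (cong _⁻¹ (odd⇒parity-1ℙ (suc n) sn-odd))

even-sum-opposite : ∀ m n → parity (m + suc n) ≡ 0ℙ → parity n ≡ parity m ⁻¹
even-sum-opposite m n even = trans (sym (suc-homo-⁻¹ n)) (cong _⁻¹ same-parity)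
  where
  same-parity : parity (suc n) ≡ parity m
  same-parity = ℙ-+-cancelˡ-≡ (parity m) _ _ (trans (trans (sym (+-homo-+ m (suc n))) even) (sym (p+p≡0ℙ (parity m))))

-- colour d: colour vertices by the parity of their distance from pv 0
-- along P or Qᵢ, where the first d edges of P are not counted.
colour : ℕ → CV → Parity
colour d (pv j)   = parity (j ∸ d)
colour d (qv _ j) = parity j

p-edge-proper : ∀ d j → d ≤ j → Proper (colour d) (pv j , pv (suc j))
p-edge-proper d j d≤j = trans (sym (suc-homo-⁻¹ (j ∸ d))) (cong (λ m → parity m ⁻¹) (sym (+-∸-assoc 1 d≤j)))

-- The edges of Qᵢ are properly coloured when the cycle P ∪ Qᵢ has even
-- length after contracting the first d edges of P.
q-edge-proper : ∀ {d k i l u v} → parity (k ∸ d + l) ≡ 0ℙ → QEdge k i l u v → Proper (colour d) (u , v)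
q-edge-proper {d} {k} even direct   = trans (cong parity (0∸n≡0 d)) (even-sum-opposite (k ∸ d) 0 even)
q-edge-proper {d}     _    first    = cong parity (0∸n≡0 d)
q-edge-proper         _    (inner {j = j}) = sym (suc-homo-⁻¹ j)
q-edge-proper {d} {k} even (last {j})      = even-sum-opposite (k ∸ d) j even

even-conjoined-proper : ∀ k ls → EvenConjoined k ls → All (Proper (colour 0)) (conjoined k ls)
even-conjoined-proper k ls even =
  ++⁺ (applyUpTo⁺₁ _ k (λ {j} _ → p-edge-proper 0 j z≤n))
      (all-pathsQ k q-edge-proper 0 ls (All.map (λ {l} → even⇒parity-0ℙ (k + l)) even))

-- The conjoined graph with first P-edge pv 0 — pv 1 deleted; by definition
-- conjoined (suc k) ls is (pv 0 , pv 1) ∷ conjoined-tail k ls.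
conjoined-tail : ℕ → List ℕ → Graph CV
conjoined-tail k ls = applyUpTo (λ j → (pv (suc j) , pv (suc (suc j)))) k ++ pathsQ (suc k) 0 ls

-- In an odd-conjoined graph this remainder is properly coloured by colour 1,
-- which gives both ends of the deleted edge the colour 0ℙ.
odd-conjoined-tail-proper : ∀ k ls → OddConjoined (suc k) ls → All (Proper (colour 1)) (conjoined-tail k ls)
odd-conjoined-tail-proper k ls odd =
  ++⁺ (applyUpTo⁺₁ _ k (λ {j} _ → p-edge-proper 1 (suc j) (s≤s z≤n)))
      (all-pathsQ (suc k) q-edge-proper 0 ls (All.map (λ {l} → odd-suc⇒parity-0ℙ (k + l)) odd))

-- P and Q₀ are two walks from pv 0 to pv k, of lengths k and l₀.
p-walk : ∀ k ls j → j < k → (pv j , pv (suc j)) ∈ conjoined k ls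
p-walk k ls j j<k = ∈-++⁺ˡ (∈-applyUpTo⁺ (λ j → (pv j , pv (suc j))) j<k)

q-walk : ∀ k l ls j → j < l → (qvert k 0 l j , qvert k 0 l (suc j)) ∈ conjoined k (l ∷ ls)
q-walk k l ls j j<l = ∈-++⁺ʳ (pathP k) (∈-++⁺ˡ (∈-applyUpTo⁺ (λ j → (qvert k 0 l j , qvert k 0 l (suc j))) j<l))

odd-conjoined-not-2-colourable : ∀ k l ls → (k + suc l) % 2 ≡ 1 → ∀ b → ¬ All (Proper b) (conjoined k (suc l ∷ ls))
odd-conjoined-not-2-colourable k l ls odd b proper = contradiction (trans (sym is-odd) is-even) λ ()
  where
  same-parity : parity k ≡ parity (suc l)
  same-parity = walks-same-parity proper pv (qvert k 0 (suc l)) k (suc l)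
                  (p-walk k (suc l ∷ ls)) (q-walk k (suc l) ls) refl (sym (qvert-end k 0 l))
  is-even : parity (k + suc l) ≡ 0ℙ
  is-even = trans (+-homo-+ k (suc l)) (trans (cong (parity k ℙ.+_) (sym same-parity)) (p+p≡0ℙ (parity k)))
  is-odd : parity (k + suc l) ≡ 1ℙ
  is-odd = odd⇒parity-1ℙ (k + suc l) odd

open Labelling code code-injective using (labelling; colouring-weak-IASI; mono-count-proper)

even-conjoined-sparing : ∀ k ls → 1 ≤ k → EvenConjoined k ls → IsSparingNumber (conjoined k ls) 0
even-conjoined-sparing k ls 1≤k even =
  ( labelling (colour 0)
  , colouring-weak-IASI (colour 0) (conjoined-oriented k ls 1≤k) (All.map different⇒one-small proper)
  , mono-count-proper (colour 0) (conjoined k ls) (conjoined k ls) proper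
  ) , λ _ _ → z≤n
  where
  proper : All (Proper (colour 0)) (conjoined k ls)
  proper = even-conjoined-proper k ls even

-- Odd-conjoined graphs: every weak IASI has a mono-indexed edge, since a
-- weak IASI without one would properly 2-colour the graph …
odd-conjoined-has-mono : ∀ k l ls → 1 ≤ k → (k + suc l) % 2 ≡ 1 →
  ∀ f → IsWeakIASI (conjoined k (suc l ∷ ls)) f → 1 ≤ monoEdges (conjoined k (suc l ∷ ls)) f
odd-conjoined-has-mono k l ls 1≤k odd f weak = n≢0⇒n>0 λ none →
  odd-conjoined-not-2-colourable k l ls odd _
    (weak-IASI-colouring (conjoined k (suc l ∷ ls)) f weak
       (λ e∈G → proj₁ (conjoined-oriented k (suc l ∷ ls) 1≤k e∈G)) none)

-- … and colour 1 yields a weak IASI whose only mono-indexed edge is pv 0 — pv 1.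
odd-conjoined-labelling : ∀ k ls → OddConjoined (suc k) ls →
  IsWeakIASI (conjoined (suc k) ls) (labelling (colour 1)) × monoEdges (conjoined (suc k) ls) (labelling (colour 1)) ≡ 1
odd-conjoined-labelling k ls odd =
  colouring-weak-IASI (colour 1) (conjoined-oriented (suc k) ls (s≤s z≤n)) (inj₁ refl ∷ All.map different⇒one-small proper) ,
  trans (cong length (filter-accept mono? {x = pv 0 , pv 1} {xs = conjoined-tail k ls} refl))
        (cong suc (mono-count-proper (colour 1) G (conjoined-tail k ls) proper))
  where
  G : Graph CV
  G = conjoined (suc k) ls
  mono? : (e : CV × CV) → Dec (card (gf G (labelling (colour 1)) e) ≡ 1)
  mono? e = card (gf G (labelling (colour 1)) e) ≟ 1
  proper : All (Proper (colour 1)) (conjoined-tail k ls)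
  proper = odd-conjoined-tail-proper k ls odd

odd-conjoined-sparing : ∀ k ls → ConjoinedParams k ls → OddConjoined k ls → IsSparingNumber (conjoined k ls) 1
odd-conjoined-sparing zero    _            (() , _)                _
odd-conjoined-sparing (suc k) []           (_ , () , _)            _
odd-conjoined-sparing (suc k) (zero ∷ ls)  (_ , _ , () ∷ _ , _)    _
odd-conjoined-sparing (suc k) (suc l ∷ ls) (1≤k , _)               odd =
  (labelling (colour 1) , odd-conjoined-labelling k (suc l ∷ ls) odd) ,
  odd-conjoined-has-mono (suc k) l ls 1≤k (All.head odd)

theorem3p2 : (k : ℕ) (ls : List ℕ) → ConjoinedParams k ls →
    (OddConjoined k ls → IsSparingNumber (conjoined k ls) 1) ×
    (EvenConjoined k ls → IsSparingNumber (conjoined k ls) 0)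
theorem3p2 k ls params@(1≤k , _) = odd-conjoined-sparing k ls params , even-conjoined-sparing k ls 1≤k
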